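{- Let $m\ge2$ and $a\in\mathbb{Q}^{m(m-1)/2}$. Then there exist an irrational number $r\in\mathbb{R}\setminus\mathbb{Q}$ and an $m$-Hadamardesque matrix $M$, all of whose entries are of the form $\pm r$, whose rows $r_1,\dots,r_m$ satisfy $$\langle r_i,r_j\rangle=a_{\frac{(j-1)(j-2)}{2}+i}\qquad\text{for all }1\le i<j\le m.$$
   Context: The matrices $T_m$ ($m\times 2^{m-1}$) are defined recursively by $T_1=[1]$ and $T_{m+1}=\begin{bmatrix} T_m & T_m\\ 1\cdots 1 & -1\cdots -1\end{bmatrix}$ (last row: $2^{m-1}$ ones then $2^{m-1}$ minus ones); its columns are all vectors $(1,\pm1,\dots,\pm1)\in\mathbb{R}^m$. An $m\times n$ real matrix $M$ is $m$-Hadamardesque if each of its columns equals $p\,c$ for some $p>0$ and some column $c$ of $T_m$. -}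

module Defs where

open import Data.Nat using (ℕ; zero; suc; _^_)
open import Data.Fin using (Fin)
open import Data.Vec using (Vec; []; _∷_; _∷ʳ_; _++_; replicate; map; lookup)
open import Data.Integer using (ℤ; +_; -_; _+_; _*_; 0ℤ; 1ℤ)
open import Data.Rational using (ℚ)
import Data.Rational as ℚ

-- T m is the matrix T_{m+1} of the paper, as a Vec of (m+1) rows,
-- each row of length 2^m.
-- T_1 = [1],  T_{k+1} = [ T_k  T_k ; 1..1  -1..-1 ].
T : (m : ℕ) → Vec (Vec ℤ (2 ^ m)) (suc m)
T zero = (1ℤ ∷ []) ∷ []
T (suc m) =
  map (λ row → row ++ (row ++ [])) (T m)
  ∷ʳ (replicate (2 ^ m) 1ℤ ++ (replicate (2 ^ m) (- 1ℤ) ++ []))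

-- Entry (row i, column c) of the paper's T_m (an m × 2^(m-1) matrix).
Tent : (m : ℕ) → Fin m → Fin (2 ^ (m Data.Nat.∸ 1)) → ℤ
Tent zero ()
Tent (suc m) i c = lookup (lookup (T m) i) c

sumℤ : (n : ℕ) → (Fin n → ℤ) → ℤ
sumℤ zero f = 0ℤ
sumℤ (suc n) f = f Fin.zero + sumℤ n (λ k → f (Fin.suc k))
  where import Data.Fin as Fin

-- A sign matrix (m × n) whose columns are columns of T_m, given by a choice
-- of column of T_m for each of the n columns.  The paper's matrix M is
-- r · S with r > 0, which is m-Hadamardesque with p = r and all entries ±r.
signMat : (m n : ℕ) → (Fin n → Fin (2 ^ (m Data.Nat.∸ 1))) → Fin m → Fin n → ℤ
signMat m n col i k = Tent m i (col k)

-- Σ_k S_ik S_jk ; the real inner product of rows i, j of M = r·S is r² times this.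
signInner : (m n : ℕ) → (Fin n → Fin (2 ^ (m Data.Nat.∸ 1))) → Fin m → Fin m → ℤ
signInner m n col i j = sumℤ n (λ k → signMat m n col i k * signMat m n col j k)

{-# OPTIONS --safe #-}
module Submission where

-- Write the sought matrix as r·S with S a ±1 matrix and q = r².  Normalising each column of S
-- to start with +1 does not change the products S_ik S_jk, so the columns of S may be taken
-- to be columns of T_m, and the problem is to find sign vectors whose Gram matrix
-- Σ_v v_i v_j equals a prescribed integer matrix 2^m·H above the diagonal.  This is done by
-- induction on m: prefixing both signs to a solution for coordinates 1..m-1 doubles its Gram
-- matrix and contributes nothing to row 0, while row 0 is filled by |h_l| copies of the sign
-- vectors v with v_0 = ±v_l, which by the orthogonality of the characters s ↦ s_k s_l
-- contribute ±2^m at (0, l) and nothing elsewhere.  Finally, with D a common denominator of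
-- the a's and Y = 2^m·D, the choice q = 1/(2Y²) makes a/q = 2^m·H with H integral, and q is
-- not a rational square because √2 is irrational.

module Sums where

  open import Data.Fin using (Fin; zero; suc)
  open import Data.Fin.Properties using (suc-injective)
  open import Data.Integer using (ℤ; +_; 0ℤ; _+_; _*_)
  import Data.Integer.Properties as ℤ
  open import Data.List using (List; []; _∷_; _++_; map; concat; replicate; tabulate)
  open import Data.Nat using (ℕ; zero; suc)
  open import Function using (_∘_)
  open import Relation.Binary.PropositionalEquality

  open import Defs using (sumℤ)

  private variable
    A B : Set
    n : ℕ

  ∑ : List A → (A → ℤ) → ℤ
  ∑ []       f = 0ℤ
  ∑ (x ∷ xs) f = f x + ∑ xs f

  syntax ∑ xs (λ x → e) = ∑[ x ∈ xs ] e

  module _ (f : A → ℤ) where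

    ∑-++ : ∀ xs ys → ∑ (xs ++ ys) f ≡ ∑ xs f + ∑ ys f
    ∑-++ []       ys = sym (ℤ.+-identityˡ (∑ ys f))
    ∑-++ (x ∷ xs) ys = trans (cong (_+_ (f x)) (∑-++ xs ys)) (sym (ℤ.+-assoc (f x) _ _))

    ∑-*ˡ : ∀ c xs → ∑[ x ∈ xs ] (c * f x) ≡ c * ∑ xs f
    ∑-*ˡ c []       = sym (ℤ.*-zeroʳ c)
    ∑-*ˡ c (x ∷ xs) = trans (cong (_+_ (c * f x)) (∑-*ˡ c xs)) (sym (ℤ.*-distribˡ-+ c (f x) _))

    ∑-concat-replicate : ∀ k xs → ∑ (concat (replicate k xs)) f ≡ + k * ∑ xs f
    ∑-concat-replicate zero    xs = sym (ℤ.*-zeroˡ (∑ xs f))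
    ∑-concat-replicate (suc k) xs = begin
      ∑ (xs ++ concat (replicate k xs)) f     ≡⟨ ∑-++ xs _ ⟩
      ∑ xs f + ∑ (concat (replicate k xs)) f  ≡⟨ cong (_+_ (∑ xs f)) (∑-concat-replicate k xs) ⟩
      ∑ xs f + + k * ∑ xs f                   ≡⟨ ℤ.suc-* (+ k) (∑ xs f) ⟨
      + suc k * ∑ xs f                        ∎
      where open ≡-Reasoning

    ∑-concat-tabulate : ∀ (g : Fin n → List A) →
                        ∑ (concat (tabulate g)) f ≡ sumℤ n (λ i → ∑ (g i) f)
    ∑-concat-tabulate {zero}  g = refl
    ∑-concat-tabulate {suc n} g =
      trans (∑-++ (g zero) _) (cong (_+_ (∑ (g zero) f)) (∑-concat-tabulate (g ∘ suc)))

  ∑-map : ∀ (f : B → ℤ) (g : A → B) xs → ∑ (map g xs) f ≡ ∑ xs (f ∘ g)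
  ∑-map f g []       = refl
  ∑-map f g (x ∷ xs) = cong (_+_ (f (g x))) (∑-map f g xs)

  ∑-cong : ∀ {f g : A → ℤ} → (∀ x → f x ≡ g x) → ∀ xs → ∑ xs f ≡ ∑ xs g
  ∑-cong f≗g []       = refl
  ∑-cong f≗g (x ∷ xs) = cong₂ _+_ (f≗g x) (∑-cong f≗g xs)

  sumℤ-cong : ∀ n {f g : Fin n → ℤ} → (∀ i → f i ≡ g i) → sumℤ n f ≡ sumℤ n g
  sumℤ-cong zero    f≗g = refl
  sumℤ-cong (suc n) f≗g = cong₂ _+_ (f≗g zero) (sumℤ-cong n (f≗g ∘ suc))

  sumℤ-zero : ∀ n {f : Fin n → ℤ} → (∀ i → f i ≡ 0ℤ) → sumℤ n f ≡ 0ℤ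
  sumℤ-zero zero    f≗0 = refl
  sumℤ-zero (suc n) f≗0 = cong₂ _+_ (f≗0 zero) (sumℤ-zero n (f≗0 ∘ suc))

  sumℤ-δ : ∀ n (f : Fin n → ℤ) k → (∀ i → i ≢ k → f i ≡ 0ℤ) → sumℤ n f ≡ f k
  sumℤ-δ (suc n) f zero    f≗0 = begin
    f zero + sumℤ n (f ∘ suc)  ≡⟨ cong (_+_ (f zero)) (sumℤ-zero n (λ i → f≗0 (suc i) λ ())) ⟩
    f zero + 0ℤ                ≡⟨ ℤ.+-identityʳ (f zero) ⟩
    f zero                     ∎
    where open ≡-Reasoning
  sumℤ-δ (suc n) f (suc k) f≗0 = begin
    f zero + sumℤ n (f ∘ suc)  ≡⟨ cong₂ _+_ (f≗0 zero λ ()) (sumℤ-δ n (f ∘ suc) k f∘suc≗0) ⟩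
    0ℤ + f (suc k)             ≡⟨ ℤ.+-identityˡ (f (suc k)) ⟩
    f (suc k)                  ∎
    where
    open ≡-Reasoning
    f∘suc≗0 : ∀ i → i ≢ k → f (suc i) ≡ 0ℤ
    f∘suc≗0 i i≢k = f≗0 (suc i) (i≢k ∘ suc-injective)


module SignVectors where

  open import Data.Empty using (⊥-elim)
  open import Data.Fin using (Fin; zero; suc; _<_)
  open import Data.Fin.Properties using (suc-injective; <⇒≢)
  open import Data.Integer using (ℤ; +_; 0ℤ; 1ℤ; -1ℤ; _+_; _*_; -_; ∣_∣; sign; _◃_)
  import Data.Integer.Properties as ℤ
  open import Data.Integer.Tactic.RingSolver using (solve-∀)
  open import Data.List using (List; []; _∷_; _++_; map; concat; replicate; tabulate; length)
  open import Data.List.Properties using (length-++; length-map)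
  open import Data.Nat as ℕ using (ℕ; zero; suc; _^_)
  import Data.Nat.Properties as ℕ
  open import Data.Product using (∃; _,_)
  open import Data.Sign as Sign using (Sign)
  import Data.Sign.Properties as Sign
  open import Data.Vec.Functional as V using (Vector; tail)
  open import Function using (_∘_)
  open import Relation.Binary.PropositionalEquality

  open import Defs using (sumℤ)
  open Sums

  private variable
    A : Set
    n : ℕ

  ⟦_⟧ : Sign → ℤ
  ⟦ s ⟧ = s ◃ 1

  ⟦⟧-* : ∀ s t → ⟦ s Sign.* t ⟧ ≡ ⟦ s ⟧ * ⟦ t ⟧
  ⟦⟧-* s t = ℤ.◃-distrib-* s t 1 1

  ⟦s⟧*⟦s⟧≡1 : ∀ s → ⟦ s ⟧ * ⟦ s ⟧ ≡ 1ℤ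
  ⟦s⟧*⟦s⟧≡1 s = trans (sym (⟦⟧-* s s)) (cong ⟦_⟧ (Sign.s*s≡+ s))

  ∣i∣*⟦sign[i]⟧≡i : ∀ i → + ∣ i ∣ * ⟦ sign i ⟧ ≡ i
  ∣i∣*⟦sign[i]⟧≡i i = begin
    + ∣ i ∣ * ⟦ sign i ⟧             ≡⟨ cong (_* ⟦ sign i ⟧) (ℤ.+◃n≡+n ∣ i ∣) ⟨
    (Sign.+ ◃ ∣ i ∣) * (sign i ◃ 1)  ≡⟨ ℤ.◃-distrib-* Sign.+ (sign i) ∣ i ∣ 1 ⟨
    sign i ◃ (∣ i ∣ ℕ.* 1)           ≡⟨ cong (sign i ◃_) (ℕ.*-identityʳ ∣ i ∣) ⟩
    sign i ◃ ∣ i ∣                   ≡⟨ ℤ.◃-inverse i ⟩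
    i                                ∎
    where open ≡-Reasoning

  signProduct : Fin n → Fin n → Vector Sign n → ℤ
  signProduct k l v = ⟦ v k ⟧ * ⟦ v l ⟧

  gram : List (Vector Sign n) → Fin n → Fin n → ℤ
  gram vs k l = ∑ vs (signProduct k l)

  gram-sym : ∀ (vs : List (Vector Sign n)) k l → gram vs k l ≡ gram vs l k
  gram-sym vs k l = ∑-cong (λ v → ℤ.*-comm ⟦ v k ⟧ ⟦ v l ⟧) vs

  gram-diagonal : ∀ (vs : List (Vector Sign n)) k → gram vs k k ≡ + length vs
  gram-diagonal []       k = refl
  gram-diagonal (v ∷ vs) k = cong₂ _+_ (⟦s⟧*⟦s⟧≡1 (v k)) (gram-diagonal vs k)

  doubling : List (Vector Sign n) → List (Vector Sign (suc n))
  doubling vs = map (Sign.+ V.∷_) vs ++ map (Sign.- V.∷_) vs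

  length-doubling : ∀ (vs : List (Vector Sign n)) → length (doubling vs) ≡ 2 ℕ.* length vs
  length-doubling vs = begin
    length (map (Sign.+ V.∷_) vs ++ map (Sign.- V.∷_) vs)
      ≡⟨ length-++ (map (Sign.+ V.∷_) vs) ⟩
    length (map (Sign.+ V.∷_) vs) ℕ.+ length (map (Sign.- V.∷_) vs)
      ≡⟨ cong₂ ℕ._+_ (length-map _ vs) (length-map _ vs) ⟩
    length vs ℕ.+ length vs
      ≡⟨ cong (length vs ℕ.+_) (ℕ.+-identityʳ (length vs)) ⟨
    2 ℕ.* length vs ∎
    where open ≡-Reasoning

  gram-doubling-zero-suc : ∀ (vs : List (Vector Sign n)) l → gram (doubling vs) zero (suc l) ≡ 0ℤ
  gram-doubling-zero-suc vs l = begin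
    gram (doubling vs) zero (suc l)
      ≡⟨ ∑-++ (signProduct zero (suc l)) (map (Sign.+ V.∷_) vs) _ ⟩
    gram (map (Sign.+ V.∷_) vs) zero (suc l) + gram (map (Sign.- V.∷_) vs) zero (suc l)
      ≡⟨ cong₂ _+_ (∑-map _ (Sign.+ V.∷_) vs) (∑-map _ (Sign.- V.∷_) vs) ⟩
    ∑[ v ∈ vs ] (1ℤ * ⟦ v l ⟧) + ∑[ v ∈ vs ] (-1ℤ * ⟦ v l ⟧)
      ≡⟨ cong₂ _+_ (∑-*ˡ (λ v → ⟦ v l ⟧) 1ℤ vs) (∑-*ˡ (λ v → ⟦ v l ⟧) -1ℤ vs) ⟩
    1ℤ * S + -1ℤ * S
      ≡⟨ cong₂ _+_ (ℤ.*-identityˡ S) (ℤ.-1*i≡-i S) ⟩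
    S + - S
      ≡⟨ ℤ.+-inverseʳ S ⟩
    0ℤ ∎
    where
    open ≡-Reasoning
    S : ℤ
    S = ∑[ v ∈ vs ] ⟦ v l ⟧

  gram-doubling-suc-suc : ∀ (vs : List (Vector Sign n)) k l →
                          gram (doubling vs) (suc k) (suc l) ≡ gram vs k l + gram vs k l
  gram-doubling-suc-suc vs k l =
    trans (∑-++ (signProduct (suc k) (suc l)) (map (Sign.+ V.∷_) vs) _)
          (cong₂ _+_ (∑-map _ (Sign.+ V.∷_) vs) (∑-map _ (Sign.- V.∷_) vs))

  signs : ∀ n → List (Vector Sign n)
  signs zero    = V.[] ∷ []
  signs (suc n) = doubling (signs n)

  length-signs : ∀ n → length (signs n) ≡ 2 ^ n
  length-signs zero    = refl
  length-signs (suc n) = trans (length-doubling (signs n)) (cong (2 ℕ.*_) (length-signs n))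

  gram-signs-≢ : ∀ n {k l : Fin n} → k ≢ l → gram (signs n) k l ≡ 0ℤ
  gram-signs-≢ (suc n) {zero}  {zero}  k≢l = ⊥-elim (k≢l refl)
  gram-signs-≢ (suc n) {zero}  {suc l} _   = gram-doubling-zero-suc (signs n) l
  gram-signs-≢ (suc n) {suc k} {zero}  _   =
    trans (gram-sym (signs (suc n)) (suc k) zero) (gram-doubling-zero-suc (signs n) k)
  gram-signs-≢ (suc n) {suc k} {suc l} k≢l =
    trans (gram-doubling-suc-suc (signs n) k l)
          (cong₂ _+_ (gram-signs-≢ n (k≢l ∘ cong suc)) (gram-signs-≢ n (k≢l ∘ cong suc)))

  -- Every sign vector whose entry 0 is s times its entry l + 1, each one twice.
  firstTiedTo : Sign → Fin n → List (Vector Sign (suc n))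
  firstTiedTo s l = map (λ v → (s Sign.* v (suc l)) V.∷ tail v) (signs (suc _))

  gram-firstTiedTo-zero-suc : ∀ s (l l′ : Fin n) →
    gram (firstTiedTo s l) zero (suc l′) ≡ ⟦ s ⟧ * gram (signs (suc n)) (suc l) (suc l′)
  gram-firstTiedTo-zero-suc {n} s l l′ = begin
    gram (firstTiedTo s l) zero (suc l′)
      ≡⟨ ∑-map _ (λ v → (s Sign.* v (suc l)) V.∷ tail v) (signs (suc n)) ⟩
    ∑[ v ∈ signs (suc n) ] (⟦ s Sign.* v (suc l) ⟧ * ⟦ v (suc l′) ⟧)
      ≡⟨ ∑-cong pull-out-s (signs (suc n)) ⟩
    ∑[ v ∈ signs (suc n) ] (⟦ s ⟧ * signProduct (suc l) (suc l′) v)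
      ≡⟨ ∑-*ˡ (signProduct (suc l) (suc l′)) ⟦ s ⟧ (signs (suc n)) ⟩
    ⟦ s ⟧ * gram (signs (suc n)) (suc l) (suc l′) ∎
    where
    open ≡-Reasoning
    pull-out-s : ∀ v →
      ⟦ s Sign.* v (suc l) ⟧ * ⟦ v (suc l′) ⟧ ≡ ⟦ s ⟧ * signProduct (suc l) (suc l′) v
    pull-out-s v = trans (cong (_* ⟦ v (suc l′) ⟧) (⟦⟧-* s (v (suc l))))
                         (ℤ.*-assoc ⟦ s ⟧ ⟦ v (suc l) ⟧ ⟦ v (suc l′) ⟧)

  gram-firstTiedTo-suc-suc : ∀ s (l k k′ : Fin n) →
    gram (firstTiedTo s l) (suc k) (suc k′) ≡ gram (signs (suc n)) (suc k) (suc k′)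
  gram-firstTiedTo-suc-suc s l k k′ = ∑-map _ (λ v → (s Sign.* v (suc l)) V.∷ tail v) (signs (suc _))

  signedCopies : ℤ → (Sign → List A) → List A
  signedCopies i G = concat (replicate ∣ i ∣ (G (sign i)))

  ∑-signedCopies : ∀ (f : A → ℤ) i G x → (∀ s → ∑ (G s) f ≡ ⟦ s ⟧ * x) →
                   ∑ (signedCopies i G) f ≡ i * x
  ∑-signedCopies f i G x ∑G≡ = begin
    ∑ (signedCopies i G) f      ≡⟨ ∑-concat-replicate f ∣ i ∣ (G (sign i)) ⟩
    + ∣ i ∣ * ∑ (G (sign i)) f  ≡⟨ cong (+ ∣ i ∣ *_) (∑G≡ (sign i)) ⟩
    + ∣ i ∣ * (⟦ sign i ⟧ * x)  ≡⟨ ℤ.*-assoc (+ ∣ i ∣) ⟦ sign i ⟧ x ⟨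
    (+ ∣ i ∣ * ⟦ sign i ⟧) * x  ≡⟨ cong (_* x) (∣i∣*⟦sign[i]⟧≡i i) ⟩
    i * x                       ∎
    where open ≡-Reasoning

  entryCopies : (Fin n → ℤ) → Fin n → List (Vector Sign (suc n))
  entryCopies h l = signedCopies (h l) (λ s → firstTiedTo s l)

  firstRow : (Fin n → ℤ) → List (Vector Sign (suc n))
  firstRow h = concat (tabulate (entryCopies h))

  gram-firstRow-zero-suc : ∀ (h : Fin n → ℤ) l′ →
                           gram (firstRow h) zero (suc l′) ≡ h l′ * + (2 ^ suc n)
  gram-firstRow-zero-suc {n} h l′ = begin
    gram (firstRow h) zero (suc l′)
      ≡⟨ ∑-concat-tabulate (signProduct zero (suc l′)) (entryCopies h) ⟩
    sumℤ n (λ l → gram (entryCopies h l) zero (suc l′))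
      ≡⟨ sumℤ-cong n (λ l → ∑-signedCopies _ (h l) (λ s → firstTiedTo s l) _
                              (λ s → gram-firstTiedTo-zero-suc s l l′)) ⟩
    sumℤ n (λ l → h l * gram (signs (suc n)) (suc l) (suc l′))
      ≡⟨ sumℤ-δ n _ l′ off-diagonal ⟩
    h l′ * gram (signs (suc n)) (suc l′) (suc l′)
      ≡⟨ cong (h l′ *_) (gram-diagonal (signs (suc n)) (suc l′)) ⟩
    h l′ * + length (signs (suc n))
      ≡⟨ cong (λ k → h l′ * + k) (length-signs (suc n)) ⟩
    h l′ * + (2 ^ suc n) ∎
    where
    open ≡-Reasoning
    off-diagonal : ∀ l → l ≢ l′ → h l * gram (signs (suc n)) (suc l) (suc l′) ≡ 0ℤ
    off-diagonal l l≢l′ =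
      trans (cong (h l *_) (gram-signs-≢ (suc n) (l≢l′ ∘ suc-injective))) (ℤ.*-zeroʳ (h l))

  gram-firstRow-suc-suc : ∀ (h : Fin n → ℤ) {k k′} → k ≢ k′ →
                          gram (firstRow h) (suc k) (suc k′) ≡ 0ℤ
  gram-firstRow-suc-suc {n} h {k} {k′} k≢k′ =
    trans (∑-concat-tabulate (signProduct (suc k) (suc k′)) (entryCopies h)) (sumℤ-zero n copies-vanish)
    where
    open ≡-Reasoning
    copies-vanish : ∀ l → gram (entryCopies h l) (suc k) (suc k′) ≡ 0ℤ
    copies-vanish l = begin
      gram (entryCopies h l) (suc k) (suc k′)
        ≡⟨ ∑-concat-replicate (signProduct (suc k) (suc k′)) ∣ h l ∣ (firstTiedTo (sign (h l)) l) ⟩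
      + ∣ h l ∣ * gram (firstTiedTo (sign (h l)) l) (suc k) (suc k′)
        ≡⟨ cong (+ ∣ h l ∣ *_) (gram-firstTiedTo-suc-suc (sign (h l)) l k k′) ⟩
      + ∣ h l ∣ * gram (signs (suc n)) (suc k) (suc k′)
        ≡⟨ cong (+ ∣ h l ∣ *_) (gram-signs-≢ (suc n) (k≢k′ ∘ suc-injective)) ⟩
      + ∣ h l ∣ * 0ℤ
        ≡⟨ ℤ.*-zeroʳ (+ ∣ h l ∣) ⟩
      0ℤ ∎

  _Realizes_ : List (Vector Sign n) → (Fin n → Fin n → ℤ) → Set
  _Realizes_ {n} vs H = ∀ {k l} → k < l → gram vs k l ≡ + (2 ^ n) * H k l

  realize : ∀ n (H : Fin n → Fin n → ℤ) → ∃ λ (vs : List (Vector Sign n)) → vs Realizes H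
  realize zero    H = [] , λ { {()} }
  realize (suc n) H with realize n (λ k l → H (suc k) (suc l))
  ... | vs , vs-realizes = doubling vs ++ firstRow h , realizes
    where
    open ≡-Reasoning
    h : Fin n → ℤ
    h l = H zero (suc l)
    realizes : (doubling vs ++ firstRow h) Realizes H
    realizes {zero} {suc l} _ = begin
      gram (doubling vs ++ firstRow h) zero (suc l)
        ≡⟨ ∑-++ (signProduct zero (suc l)) (doubling vs) (firstRow h) ⟩
      gram (doubling vs) zero (suc l) + gram (firstRow h) zero (suc l)
        ≡⟨ cong₂ _+_ (gram-doubling-zero-suc vs l) (gram-firstRow-zero-suc h l) ⟩
      0ℤ + h l * + (2 ^ suc n)
        ≡⟨ trans (ℤ.+-identityˡ _) (ℤ.*-comm (h l) _) ⟩
      + (2 ^ suc n) * H zero (suc l) ∎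
    realizes {suc k} {suc l} 1+k<1+l = begin
      gram (doubling vs ++ firstRow h) (suc k) (suc l)
        ≡⟨ ∑-++ (signProduct (suc k) (suc l)) (doubling vs) (firstRow h) ⟩
      gram (doubling vs) (suc k) (suc l) + gram (firstRow h) (suc k) (suc l)
        ≡⟨ cong₂ _+_ (gram-doubling-suc-suc vs k l) (gram-firstRow-suc-suc h (<⇒≢ k<l)) ⟩
      (gram vs k l + gram vs k l) + 0ℤ
        ≡⟨ cong (λ x → (x + x) + 0ℤ) (vs-realizes k<l) ⟩
      (+ (2 ^ n) * H′ + + (2 ^ n) * H′) + 0ℤ
        ≡⟨ double (+ (2 ^ n)) H′ ⟩
      (+ 2 * + (2 ^ n)) * H′
        ≡⟨ cong (_* H′) (ℤ.pos-* 2 (2 ^ n)) ⟨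
      + (2 ^ suc n) * H′ ∎
      where
      H′ : ℤ
      H′ = H (suc k) (suc l)
      k<l : k < l
      k<l = ℕ.s<s⁻¹ 1+k<1+l
      double : ∀ a x → (a * x + a * x) + 0ℤ ≡ (+ 2 * a) * x
      double = solve-∀


module ColumnsOfT where

  open import Data.Fin using (Fin; zero; suc; inject₁; fromℕ; _↑ˡ_; _↑ʳ_)
  open import Data.Fin.Relation.Unary.Top using (view; ‵fromℕ; ‵inject₁)
  open import Data.Integer using (ℤ; 1ℤ; -_; _+_; _*_)
  import Data.Integer.Properties as ℤ
  open import Data.Integer.Tactic.RingSolver using (solve-∀)
  open import Data.List as List using (List; []; _∷_; length)
  open import Data.Nat as ℕ using (ℕ; zero; suc; _^_)
  open import Data.Product using (∃; _,_; proj₁; proj₂)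
  open import Data.Sign as Sign using (Sign)
  import Data.Sign.Properties as Sign
  open import Data.Vec as Vec using (Vec; []; _∷_; _∷ʳ_; lookup)
  open import Data.Vec.Functional using (Vector)
  open import Data.Vec.Properties using (lookup-map; lookup-++ˡ; lookup-++ʳ; lookup-replicate)
  open import Function using (_∘_)
  open import Relation.Binary.PropositionalEquality

  open import Defs using (T; Tent; signInner)
  open SignVectors using (⟦_⟧; ⟦⟧-*; ⟦s⟧*⟦s⟧≡1; signProduct; gram)

  private variable
    A : Set
    n : ℕ

  lookup-∷ʳ-inject₁ : ∀ (xs : Vec A n) x i → lookup (xs ∷ʳ x) (inject₁ i) ≡ lookup xs i
  lookup-∷ʳ-inject₁ (y ∷ xs) x zero    = refl
  lookup-∷ʳ-inject₁ (y ∷ xs) x (suc i) = lookup-∷ʳ-inject₁ xs x i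

  lookup-∷ʳ-fromℕ : ∀ (xs : Vec A n) x → lookup (xs ∷ʳ x) (fromℕ n) ≡ x
  lookup-∷ʳ-fromℕ []       x = refl
  lookup-∷ʳ-fromℕ (y ∷ xs) x = lookup-∷ʳ-fromℕ xs x

  half : Sign → Fin n → Fin (n ℕ.+ (n ℕ.+ 0))
  half {n} Sign.+ c = c ↑ˡ (n ℕ.+ 0)
  half {n} Sign.- c = n ↑ʳ (c ↑ˡ 0)

  lookup-half-dup : ∀ (r : Vec A n) s c → lookup (r Vec.++ (r Vec.++ [])) (half s c) ≡ lookup r c
  lookup-half-dup r Sign.+ c = lookup-++ˡ r _ c
  lookup-half-dup r Sign.- c = trans (lookup-++ʳ r _ (c ↑ˡ 0)) (lookup-++ˡ r [] c)

  lookup-half-signs : ∀ n s (c : Fin n) →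
    lookup (Vec.replicate n 1ℤ Vec.++ (Vec.replicate n (- 1ℤ) Vec.++ [])) (half s c) ≡ ⟦ s ⟧
  lookup-half-signs n Sign.+ c = trans (lookup-++ˡ (Vec.replicate n 1ℤ) _ c) (lookup-replicate c 1ℤ)
  lookup-half-signs n Sign.- c =
    trans (lookup-++ʳ (Vec.replicate n 1ℤ) _ (c ↑ˡ 0))
          (trans (lookup-++ˡ (Vec.replicate n (- 1ℤ)) [] c) (lookup-replicate c (- 1ℤ)))

  Tent-inject₁ : ∀ m j s (c : Fin (2 ^ m)) → Tent (2 ℕ.+ m) (inject₁ j) (half s c) ≡ Tent (suc m) j c
  Tent-inject₁ m j s c = begin
    lookup (lookup (T (suc m)) (inject₁ j)) (half s c)
      ≡⟨ cong (λ r → lookup r (half s c)) (lookup-∷ʳ-inject₁ (Vec.map duplicate (T m)) _ j) ⟩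
    lookup (lookup (Vec.map duplicate (T m)) j) (half s c)
      ≡⟨ cong (λ r → lookup r (half s c)) (lookup-map j duplicate (T m)) ⟩
    lookup (duplicate (lookup (T m) j)) (half s c)
      ≡⟨ lookup-half-dup (lookup (T m) j) s c ⟩
    lookup (lookup (T m) j) c ∎
    where
    open ≡-Reasoning
    duplicate : Vec ℤ (2 ^ m) → Vec ℤ (2 ^ suc m)
    duplicate r = r Vec.++ (r Vec.++ [])

  Tent-fromℕ : ∀ m s (c : Fin (2 ^ m)) → Tent (2 ℕ.+ m) (fromℕ (suc m)) (half s c) ≡ ⟦ s ⟧
  Tent-fromℕ m s c = trans (cong (λ r → lookup r (half s c)) (lookup-∷ʳ-fromℕ (Vec.map _ (T m)) _))
                           (lookup-half-signs (2 ^ m) s c)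

  T-column : ∀ m (u : Vector Sign (suc m)) → u zero ≡ Sign.+ →
             ∃ λ c → ∀ i → Tent (suc m) i c ≡ ⟦ u i ⟧
  T-column zero    u u₀≡+ = zero , λ { zero → cong ⟦_⟧ (sym u₀≡+) }
  T-column (suc m) u u₀≡+ with T-column m (u ∘ inject₁) u₀≡+
  ... | c , c-entries = half (u (fromℕ (suc m))) c , entries
    where
    entries : ∀ i → Tent (2 ℕ.+ m) i (half (u (fromℕ (suc m))) c) ≡ ⟦ u i ⟧
    entries i with view i
    ... | ‵fromℕ     = Tent-fromℕ m (u (fromℕ (suc m))) c
    ... | ‵inject₁ j = trans (Tent-inject₁ m j (u (fromℕ (suc m))) c) (c-entries j)

  normalise : ∀ {m} → Vector Sign (suc m) → Vector Sign (suc m)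
  normalise v i = v zero Sign.* v i

  columnOf : ∀ {m} → Vector Sign (suc m) → Fin (2 ^ m)
  columnOf {m} v = proj₁ (T-column m (normalise v) (Sign.s*s≡+ (v zero)))

  Tent-columnOf : ∀ {m} (v : Vector Sign (suc m)) i j →
    Tent (suc m) i (columnOf v) * Tent (suc m) j (columnOf v) ≡ signProduct i j v
  Tent-columnOf {m} v i j = begin
    Tent (suc m) i (columnOf v) * Tent (suc m) j (columnOf v)
      ≡⟨ cong₂ _*_ (entries i) (entries j) ⟩
    ⟦ v zero Sign.* v i ⟧ * ⟦ v zero Sign.* v j ⟧
      ≡⟨ cong₂ _*_ (⟦⟧-* (v zero) (v i)) (⟦⟧-* (v zero) (v j)) ⟩
    (⟦ v zero ⟧ * ⟦ v i ⟧) * (⟦ v zero ⟧ * ⟦ v j ⟧)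
      ≡⟨ interchange ⟦ v zero ⟧ ⟦ v i ⟧ ⟦ v j ⟧ ⟩
    (⟦ v zero ⟧ * ⟦ v zero ⟧) * signProduct i j v
      ≡⟨ cong (_* signProduct i j v) (⟦s⟧*⟦s⟧≡1 (v zero)) ⟩
    1ℤ * signProduct i j v
      ≡⟨ ℤ.*-identityˡ (signProduct i j v) ⟩
    signProduct i j v ∎
    where
    open ≡-Reasoning
    entries : ∀ i → Tent (suc m) i (columnOf v) ≡ ⟦ normalise v i ⟧
    entries = proj₂ (T-column m (normalise v) (Sign.s*s≡+ (v zero)))
    interchange : ∀ a b c → (a * b) * (a * c) ≡ (a * a) * (b * c)
    interchange = solve-∀

  signInner-columnOf : ∀ {m} (vs : List (Vector Sign (suc m))) i j →
    signInner (suc m) (length vs) (columnOf ∘ List.lookup vs) i j ≡ gram vs i j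
  signInner-columnOf []       i j = refl
  signInner-columnOf (v ∷ vs) i j = cong₂ _+_ (Tent-columnOf v i j) (signInner-columnOf vs i j)


module Rationals where

  open import Data.Empty using (⊥-elim)
  open import Data.Fin using (zero; suc)
  open import Data.Integer as ℤ using (ℤ; +_; ∣_∣)
  import Data.Integer.Properties as ℤ
  open import Data.Integer.Tactic.RingSolver using (solve-∀)
  open import Data.Nat as ℕ using (ℕ; zero; suc; NonZero; _<_)
  import Data.Nat.Properties as ℕ
  import Data.Nat.Tactic.RingSolver as ℕ-Solver
  open import Data.Nat.Divisibility using (_∣_; divides)
  open import Data.Nat.Induction using (<-rec)
  open import Data.Nat.Primality using (euclidsLemma; prime[2])
  open import Data.Product using (∃; ∃₂; _×_; _,_)
  open import Data.Rational using (ℚ; mkℚ; 0ℚ; _/_; _*_; ↥_; ↧_; ↧ₙ_; toℚᵘ) renaming (_<_ to _<ℚ_)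
  import Data.Rational.Properties as ℚ
  open import Data.Rational.Unnormalised using (mkℚᵘ; *≡*) renaming (_*_ to _*ᵘ_)
  import Data.Rational.Unnormalised.Properties as ℚᵘ
  open import Data.Sum using ([_,_]′)
  open import Data.Vec using (Vec; []; _∷_; lookup; map)
  open import Data.Vec.Properties using (lookup-map)
  open import Function using (id)
  open import Relation.Binary.PropositionalEquality

  private variable
    n : ℕ

  /≡/⇒*≡* : ∀ i j m n .{{_ : NonZero m}} .{{_ : NonZero n}} →
            i / m ≡ j / n → i ℤ.* + n ≡ j ℤ.* + m
  /≡/⇒*≡* i j (suc m) (suc n) eq =
    ℚᵘ.drop-*≡* {mkℚᵘ i m} {mkℚᵘ j n} (ℚ./-injective-≃ (mkℚᵘ i m) (mkℚᵘ j n) eq)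

  *≡*⇒/≡/ : ∀ i j m n .{{_ : NonZero m}} .{{_ : NonZero n}} →
            i ℤ.* + n ≡ j ℤ.* + m → i / m ≡ j / n
  *≡*⇒/≡/ i j (suc m) (suc n) eq = ℚ.fromℚᵘ-cong {mkℚᵘ i m} {mkℚᵘ j n} (*≡* eq)

  [i/m]*[j/n]≡[i*j]/[m*n] : ∀ i j m n .{{_ : NonZero m}} .{{_ : NonZero n}} →
                            (i / m) * (j / n) ≡ _/_ (i ℤ.* j) (m ℕ.* n) {{ℕ.m*n≢0 m n}}
  [i/m]*[j/n]≡[i*j]/[m*n] i j (suc m) (suc n) = ℚ.toℚᵘ-injective (begin
    toℚᵘ ((i / suc m) * (j / suc n))
      ≈⟨ ℚ.toℚᵘ-homo-* (i / suc m) (j / suc n) ⟩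
    toℚᵘ (i / suc m) *ᵘ toℚᵘ (j / suc n)
      ≈⟨ ℚᵘ.*-cong (ℚ.toℚᵘ-fromℚᵘ (mkℚᵘ i m)) (ℚ.toℚᵘ-fromℚᵘ (mkℚᵘ j n)) ⟩
    mkℚᵘ i m *ᵘ mkℚᵘ j n
      ≈⟨ ℚ.toℚᵘ-fromℚᵘ (mkℚᵘ i m *ᵘ mkℚᵘ j n) ⟨
    toℚᵘ ((i ℤ.* j) / (suc m ℕ.* suc n)) ∎)
    where open ℚᵘ.≃-Reasoning

  commonDenominator : (a : Vec ℚ n) →
                      ∃₂ λ d (z : Vec ℤ n) → ∀ t → lookup z t / suc d ≡ lookup a t
  commonDenominator []      = 0 , [] , λ ()
  commonDenominator (x ∷ a) with commonDenominator a
  ... | d , z , z/d≡a = ℕ.pred D , (↥ x ℤ.* + suc d) ∷ map (ℤ._* ↧ x) z , entries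
    where
    -- ℕ.pred loses nothing: D reduces to a successor since ↧ₙ x does.
    D : ℕ
    D = ↧ₙ x ℕ.* suc d
    +D≡↧x*d : + D ≡ ↧ x ℤ.* + suc d
    +D≡↧x*d = ℤ.pos-* (↧ₙ x) (suc d)
    swap : ∀ a b c → (a ℤ.* b) ℤ.* c ≡ a ℤ.* (c ℤ.* b)
    swap = solve-∀
    entries : ∀ t → lookup ((↥ x ℤ.* + suc d) ∷ map (ℤ._* ↧ x) z) t / D ≡ lookup (x ∷ a) t
    entries zero = trans (*≡*⇒/≡/ (↥ x ℤ.* + suc d) (↥ x) D (↧ₙ x) cancel-d) (ℚ.↥p/↧p≡p x)
      where
      cancel-d : (↥ x ℤ.* + suc d) ℤ.* ↧ x ≡ ↥ x ℤ.* + D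
      cancel-d = trans (swap (↥ x) (+ suc d) (↧ x)) (cong (↥ x ℤ.*_) (sym +D≡↧x*d))
    entries (suc t) = begin
      lookup (map (ℤ._* ↧ x) z) t / D
        ≡⟨ cong (_/ D) (lookup-map t (ℤ._* ↧ x) z) ⟩
      (lookup z t ℤ.* ↧ x) / D
        ≡⟨ *≡*⇒/≡/ (lookup z t ℤ.* ↧ x) (lookup z t) D (suc d) cancel-↧x ⟩
      lookup z t / suc d
        ≡⟨ z/d≡a t ⟩
      lookup a t ∎
      where
      open ≡-Reasoning
      cancel-↧x : (lookup z t ℤ.* ↧ x) ℤ.* + suc d ≡ lookup z t ℤ.* + D
      cancel-↧x = trans (ℤ.*-assoc (lookup z t) (↧ x) (+ suc d)) (cong (lookup z t ℤ.*_) (sym +D≡↧x*d))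

  rescale : ∀ c D i .{{_ : NonZero D}} .{{_ : NonZero (2 ℕ.* ((c ℕ.* D) ℕ.* (c ℕ.* D)))}} →
    (+ 1 / (2 ℕ.* ((c ℕ.* D) ℕ.* (c ℕ.* D)))) * ((+ c ℤ.* (i ℤ.* + (2 ℕ.* c ℕ.* D))) / 1) ≡ i / D
  rescale c D i = begin
    (+ 1 / E) * ((+ c ℤ.* (i ℤ.* + K)) / 1)
      ≡⟨ [i/m]*[j/n]≡[i*j]/[m*n] (+ 1) (+ c ℤ.* (i ℤ.* + K)) E 1 ⟩
    _/_ (+ 1 ℤ.* (+ c ℤ.* (i ℤ.* + K))) (E ℕ.* 1) {{ℕ.m*n≢0 E 1}}
      ≡⟨ *≡*⇒/≡/ (+ 1 ℤ.* (+ c ℤ.* (i ℤ.* + K))) i (E ℕ.* 1) D {{ℕ.m*n≢0 E 1}} cross ⟩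
    i / D ∎
    where
    open ≡-Reasoning
    E K : ℕ
    E = 2 ℕ.* ((c ℕ.* D) ℕ.* (c ℕ.* D))
    K = 2 ℕ.* c ℕ.* D
    regroup : ∀ i c K D → (+ 1 ℤ.* (c ℤ.* (i ℤ.* K))) ℤ.* D ≡ i ℤ.* ((c ℤ.* K) ℤ.* D)
    regroup = solve-∀
    c*K*D≡E*1 : ∀ c D →
      (c ℕ.* (2 ℕ.* c ℕ.* D)) ℕ.* D ≡ (2 ℕ.* ((c ℕ.* D) ℕ.* (c ℕ.* D))) ℕ.* 1
    c*K*D≡E*1 = ℕ-Solver.solve-∀
    cross : (+ 1 ℤ.* (+ c ℤ.* (i ℤ.* + K))) ℤ.* + D ≡ i ℤ.* + (E ℕ.* 1)
    cross = begin
      (+ 1 ℤ.* (+ c ℤ.* (i ℤ.* + K))) ℤ.* + D  ≡⟨ regroup i (+ c) (+ K) (+ D) ⟩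
      i ℤ.* ((+ c ℤ.* + K) ℤ.* + D)            ≡⟨ cong (λ y → i ℤ.* (y ℤ.* + D)) (ℤ.pos-* c K) ⟨
      i ℤ.* (+ (c ℕ.* K) ℤ.* + D)              ≡⟨ cong (i ℤ.*_) (ℤ.pos-* (c ℕ.* K) D) ⟨
      i ℤ.* + ((c ℕ.* K) ℕ.* D)                ≡⟨ cong (λ y → i ℤ.* + y) (c*K*D≡E*1 c D) ⟩
      i ℤ.* + (E ℕ.* 1)                        ∎

  2∣n*n⇒2∣n : ∀ n → 2 ∣ n ℕ.* n → 2 ∣ n
  2∣n*n⇒2∣n n 2∣n*n = [ id , id ]′ (euclidsLemma n n prime[2] 2∣n*n)

  2*m*m≡n*n⇒n≡0 : ∀ m n → 2 ℕ.* (m ℕ.* m) ≡ n ℕ.* n → n ≡ 0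
  2*m*m≡n*n⇒n≡0 m n = <-rec P descent n m
    where
    P : ℕ → Set
    P n = ∀ m → 2 ℕ.* (m ℕ.* m) ≡ n ℕ.* n → n ≡ 0
    square-double : ∀ x → (x ℕ.* 2) ℕ.* (x ℕ.* 2) ≡ 2 ℕ.* (2 ℕ.* (x ℕ.* x))
    square-double = ℕ-Solver.solve-∀
    halve : ∀ k m → 2 ℕ.* (m ℕ.* m) ≡ (k ℕ.* 2) ℕ.* (k ℕ.* 2) →
            ∃ λ j → 2 ℕ.* (j ℕ.* j) ≡ k ℕ.* k
    halve k m eq = halve′ (2∣n*n⇒2∣n m (divides (k ℕ.* k) m*m≡k*k*2))
      where
      m*m≡2*k*k : m ℕ.* m ≡ 2 ℕ.* (k ℕ.* k)
      m*m≡2*k*k = ℕ.*-cancelˡ-≡ _ _ 2 (trans eq (square-double k))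
      m*m≡k*k*2 : m ℕ.* m ≡ (k ℕ.* k) ℕ.* 2
      m*m≡k*k*2 = trans m*m≡2*k*k (ℕ.*-comm 2 (k ℕ.* k))
      halve′ : 2 ∣ m → ∃ λ j → 2 ℕ.* (j ℕ.* j) ≡ k ℕ.* k
      halve′ (divides j refl) = j , ℕ.*-cancelˡ-≡ _ _ 2 (trans (sym (square-double j)) m*m≡2*k*k)
    descent : ∀ n → (∀ {n′} → n′ < n → P n′) → P n
    descent n rec m eq with 2∣n*n⇒2∣n n (divides (m ℕ.* m) (trans (sym eq) (ℕ.*-comm 2 (m ℕ.* m))))
    ... | divides zero    n≡0  = n≡0
    ... | divides (suc k) refl with halve (suc k) m eq
    ...   | j , 2*j*j≡k*k = ⊥-elim (ℕ.1+n≢0 (rec (ℕ.m<m*n (suc k) 2 ℕ.≤-refl) j 2*j*j≡k*k))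

  x*x≢1/[2*Y*Y] : ∀ Y .{{_ : NonZero (2 ℕ.* (Y ℕ.* Y))}} (x : ℚ) → x * x ≢ + 1 / (2 ℕ.* (Y ℕ.* Y))
  x*x≢1/[2*Y*Y] Y x@(mkℚ i e _) x*x≡ = ℕ.1+n≢0 (2*m*m≡n*n⇒n≡0 (∣ i ∣ ℕ.* Y) (suc e) 2*[iY]²≡d²)
    where
    open ≡-Reasoning
    E d : ℕ
    E = 2 ℕ.* (Y ℕ.* Y)
    d = suc e
    cross : (i ℤ.* i) ℤ.* + E ≡ + 1 ℤ.* + (d ℕ.* d)
    cross = /≡/⇒*≡* (i ℤ.* i) (+ 1) (d ℕ.* d) E x*x≡
    rearrange : ∀ a y → 2 ℕ.* ((a ℕ.* y) ℕ.* (a ℕ.* y)) ≡ (a ℕ.* a) ℕ.* (2 ℕ.* (y ℕ.* y))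
    rearrange = ℕ-Solver.solve-∀
    2*[iY]²≡d² : 2 ℕ.* ((∣ i ∣ ℕ.* Y) ℕ.* (∣ i ∣ ℕ.* Y)) ≡ d ℕ.* d
    2*[iY]²≡d² = begin
      2 ℕ.* ((∣ i ∣ ℕ.* Y) ℕ.* (∣ i ∣ ℕ.* Y))  ≡⟨ rearrange ∣ i ∣ Y ⟩
      (∣ i ∣ ℕ.* ∣ i ∣) ℕ.* E                  ≡⟨ cong (ℕ._* E) (ℤ.abs-* i i) ⟨
      ∣ i ℤ.* i ∣ ℕ.* E                        ≡⟨ ℤ.abs-* (i ℤ.* i) (+ E) ⟨
      ∣ (i ℤ.* i) ℤ.* + E ∣                    ≡⟨ cong ∣_∣ (trans cross (ℤ.*-identityˡ (+ (d ℕ.* d)))) ⟩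
      d ℕ.* d                                  ∎

  nonSquareScaling : ∀ c .{{_ : NonZero c}} (a : Vec ℚ n) →
    ∃ λ q → 0ℚ <ℚ q × (∀ x → x * x ≢ q) ×
      ∃ λ (w : Vec ℤ n) → ∀ t → q * ((+ c ℤ.* lookup w t) / 1) ≡ lookup a t
  nonSquareScaling c a with commonDenominator a
  ... | d , z , z/d≡a =
    q , ℚ.positive⁻¹ q {{ℚ.normalize-pos 1 E}} , x*x≢1/[2*Y*Y] Y , map (ℤ._* + K) z , entries
    where
    Y E K : ℕ
    Y = c ℕ.* suc d
    E = 2 ℕ.* (Y ℕ.* Y)
    K = 2 ℕ.* c ℕ.* suc d
    instance
      Y≢0 : NonZero Y
      Y≢0 = ℕ.m*n≢0 c (suc d)
      E≢0 : NonZero E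
      E≢0 = ℕ.m*n≢0 2 (Y ℕ.* Y) {{_}} {{ℕ.m*n≢0 Y Y}}
    q : ℚ
    q = + 1 / E
    entries : ∀ t → q * ((+ c ℤ.* lookup (map (ℤ._* + K) z) t) / 1) ≡ lookup a t
    entries t = begin
      q * ((+ c ℤ.* lookup (map (ℤ._* + K) z) t) / 1)  ≡⟨ cong (λ y → q * ((+ c ℤ.* y) / 1)) (lookup-map t _ z) ⟩
      q * ((+ c ℤ.* (lookup z t ℤ.* + K)) / 1)         ≡⟨ rescale c (suc d) (lookup z t) ⟩
      lookup z t / suc d                               ≡⟨ z/d≡a t ⟩
      lookup a t                                       ∎
      where open ≡-Reasoning


open import Data.Fin using (Fin; toℕ; fromℕ<)
open import Data.Integer as ℤ using (ℤ; +_; 0ℤ)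
open import Data.List as List using (List; length)
open import Data.Nat using (ℕ; zero; suc; s<s⁻¹; _≤_; _<_; _∸_; _/_; _+_; _^_)
  renaming (_*_ to _*ℕ_)
import Data.Nat.Properties as ℕ
open import Data.Product using (Σ; _×_; _,_; proj₁; proj₂)
open import Data.Rational using (ℚ; 0ℚ; _*_) renaming (_<_ to _<ℚ_; _/_ to _/ℚ_)
open import Data.Sign using (Sign)
open import Data.Vec using (Vec; []; _∷_; lookup)
open import Data.Vec.Functional using (Vector)
open import Function using (_∘_)
open import Relation.Binary.PropositionalEquality using (_≡_; _≢_; refl; cong; module ≡-Reasoning)

open import Defs using (signInner)
open SignVectors using (gram; realize)
open ColumnsOfT using (columnOf; signInner-columnOf)
open Rationals using (nonSquareScaling)

lookupOr : {A : Set} {n : ℕ} → A → Vec A n → ℕ → A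
lookupOr d []       t       = d
lookupOr d (x ∷ xs) zero    = x
lookupOr d (x ∷ xs) (suc t) = lookupOr d xs t

lookupOr-fromℕ< : {A : Set} {n : ℕ} (d : A) (xs : Vec A n) {t : ℕ} (t<n : t < n) →
                  lookupOr d xs t ≡ lookup xs (fromℕ< t<n)
lookupOr-fromℕ< d (x ∷ xs) {zero}  _   = refl
lookupOr-fromℕ< d (x ∷ xs) {suc t} t<n = lookupOr-fromℕ< d xs (s<s⁻¹ t<n)

mainTheorem12 : (m : ℕ) → 2 ≤ m → (a : Vec ℚ ((m *ℕ (m ∸ 1)) / 2)) →
    Σ ℚ λ q → (0ℚ <ℚ q) × ((x : ℚ) → x * x ≢ q) ×
      Σ ℕ λ n → Σ (Fin n → Fin (2 ^ (m ∸ 1))) λ col →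
        (i j : Fin m) → toℕ i < toℕ j →
          (p : (toℕ j *ℕ (toℕ j ∸ 1)) / 2 + toℕ i < (m *ℕ (m ∸ 1)) / 2) →
            q * (signInner m n col i j /ℚ 1) ≡ lookup a (fromℕ< p)
mainTheorem12 m@(suc m-1) _ a with nonSquareScaling (2 ^ m) {{ℕ.m^n≢0 2 m}} a
... | q , 0<q , x*x≢q , w , q*[2^m*w]≡a = q , 0<q , x*x≢q , length vs , columnOf ∘ List.lookup vs , entries
  where
  pairIndex : Fin m → Fin m → ℕ
  pairIndex i j = (toℕ j *ℕ (toℕ j ∸ 1)) / 2 + toℕ i
  -- The default 0 is never read: pairIndex i j is in range whenever i < j.
  H : Fin m → Fin m → ℤ
  H i j = lookupOr 0ℤ w (pairIndex i j)
  vs : List (Vector Sign m)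
  vs = proj₁ (realize m H)
  entries : ∀ i j → toℕ i < toℕ j → (p : pairIndex i j < (m *ℕ m-1) / 2) →
            q * (signInner m (length vs) (columnOf ∘ List.lookup vs) i j /ℚ 1) ≡ lookup a (fromℕ< p)
  entries i j i<j p = begin
    q * (signInner m (length vs) (columnOf ∘ List.lookup vs) i j /ℚ 1)
      ≡⟨ cong (λ x → q * (x /ℚ 1)) (signInner-columnOf vs i j) ⟩
    q * (gram vs i j /ℚ 1)
      ≡⟨ cong (λ x → q * (x /ℚ 1)) (proj₂ (realize m H) i<j) ⟩
    q * ((+ (2 ^ m) ℤ.* H i j) /ℚ 1)
      ≡⟨ cong (λ x → q * ((+ (2 ^ m) ℤ.* x) /ℚ 1)) (lookupOr-fromℕ< 0ℤ w p) ⟩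
    q * ((+ (2 ^ m) ℤ.* lookup w (fromℕ< p)) /ℚ 1)
      ≡⟨ q*[2^m*w]≡a (fromℕ< p) ⟩
    lookup a (fromℕ< p) ∎
    where open ≡-Reasoning
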